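{- Let $n\ge1$ and $\sigma,\tau\in B_n$. If $\sigma(1)\neq\tau(1)$ then $\mathrm{inv}_1\,\sigma\neq\mathrm{inv}_1\,\tau$.
   Context: $B_n$ is the hyperoctahedral group of signed permutations: bijections $\pi$ of $\{\pm1,\dots,\pm n\}$ with $\pi(-x)=-\pi(x)$; equivalently $\pi$ is determined by $(\pi(1),\dots,\pi(n))$ with $\pi(i)\in\{\pm1,\dots,\pm n\}$ and $(|\pi(1)|,\dots,|\pi(n)|)$ a permutation of $\{1,\dots,n\}$. For $i\in\{1,\dots,n\}$ the number of $i$-inversions of $\pi$ is: if $\pi(i)=j>0$, $\mathrm{inv}_i(\pi)=\#\{k\in\{i+1,\dots,n\}: |\pi(k)|<j\}$; if $\pi(i)=-j<0$, $\mathrm{inv}_i(\pi)=1+\#\{k\in\{i+1,\dots,n\}: |\pi(k)|<j\}+2\,\#\{k\in\{i+1,\dots,n\}: |\pi(k)|>j\}$. -}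

module Defs where

open import Data.Nat using (ℕ; suc; _+_; _*_; _<_; _>_; _<?_)
open import Data.Fin using (Fin; toℕ)
open import Data.Fin.Permutation using (Permutation′; _⟨$⟩ʳ_)
open import Data.Bool using (Bool; true; false)
open import Data.Integer using (ℤ; +_; -_)
open import Data.List using (List; length; filter; allFin)
open import Data.Product using (_×_; _,_)
open import Relation.Nullary.Decidable using (_×-dec_)

-- A signed permutation π ∈ B_n, represented by the underlying permutation
-- |π| of {1..n} (as a permutation of Fin n, value v ↦ toℕ v + 1) together
-- with a sign for each position: sign i = true means π(i) is negative.
record SignedPerm (n : ℕ) : Set where
  constructor sperm
  field
    perm : Permutation′ n
    neg  : Fin n → Bool

open SignedPerm public

absVal : ∀ {n} → SignedPerm n → Fin n → ℕ
absVal π i = suc (toℕ (perm π ⟨$⟩ʳ i))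

value : ∀ {n} → SignedPerm n → Fin n → ℤ
value π i with neg π i
... | false = + absVal π i
... | true  = - (+ absVal π i)

countSmaller : ∀ {n} → SignedPerm n → Fin n → ℕ → ℕ
countSmaller {n} π i j =
  length (filter (λ k → (toℕ i <? toℕ k) ×-dec (absVal π k <? j)) (allFin n))

countLarger : ∀ {n} → SignedPerm n → Fin n → ℕ → ℕ
countLarger {n} π i j =
  length (filter (λ k → (toℕ i <? toℕ k) ×-dec (j <? absVal π k)) (allFin n))

-- number of i-inversions (positions are 0-indexed: Fin n index i is position i+1)
inv : ∀ {n} → SignedPerm n → Fin n → ℕ
inv π i with neg π i
... | false = countSmaller π i (absVal π i)
... | true  = 1 + countSmaller π i (absVal π i) + 2 * countLarger π i (absVal π i)

{-# OPTIONS --safe #-}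
-- If |σ(1)| = a + 1, then exactly a of the later absolute values are smaller
-- and m − a are larger, so inv₁ σ is a when σ(1) > 0 and 1 + a + 2(m − a) =
-- 1 + m + (m − a) when σ(1) < 0.  Each expression is injective in a ∈ [0, m],
-- the first takes values in [0, m] and the second in [m + 1, 2m + 1]; hence
-- inv₁ σ determines σ(1).
module Submission where

open import Defs
open import Data.Nat using (ℕ; zero; suc; _+_; _*_; _∸_; _≤_; _<_; _<?_; z≤n; s≤s; s≤s⁻¹)
open import Data.Nat.Properties
  using (+-0-commutativeMonoid; +-identityʳ; +-assoc; +-cancelˡ-≡; m+[n∸m]≡n; ∸-cancelˡ-≡;
         m≤m+n; ≤-trans; <⇒≢; n≮n; *-identityʳ; *-zeroʳ; n≤1+n; ≤-<-trans)
open import Data.Fin using (Fin; zero; suc; toℕ)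
open import Data.Fin.Properties using (toℕ<n)
open import Data.Fin.Permutation using (_⟨$⟩ʳ_)
open import Data.Bool using (Bool; true; false)
import Data.Integer as ℤ
open import Data.List using (length; filter; tabulate; allFin)
open import Data.Product using (_×_; _,_)
open import Function using (id; _⇔_; mk⇔; Equivalence)
open import Relation.Nullary using (Dec; yes; no; ¬_; contradiction)
open import Relation.Nullary.Decidable using (_×-dec_)
open import Relation.Unary using (Pred; Decidable)
open import Relation.Binary.PropositionalEquality
open import Algebra.Properties.CommutativeMonoid.Sum +-0-commutativeMonoid
  using (sum-syntax; sum-cong-≗; sum-permute)

𝟙 : ∀ {a} {A : Set a} → Dec A → ℕ
𝟙 (yes _) = 1
𝟙 (no _)  = 0

𝟙-yes : ∀ {a} {A : Set a} (A? : Dec A) → A → 𝟙 A? ≡ 1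
𝟙-yes (yes _) _ = refl
𝟙-yes (no ¬a) a = contradiction a ¬a

𝟙-no : ∀ {a} {A : Set a} (A? : Dec A) → ¬ A → 𝟙 A? ≡ 0
𝟙-no (yes a) ¬a = contradiction a ¬a
𝟙-no (no _)  _  = refl

𝟙-cong : ∀ {a b} {A : Set a} {B : Set b} (A? : Dec A) (B? : Dec B) → A ⇔ B → 𝟙 A? ≡ 𝟙 B?
𝟙-cong A? (yes b) A⇔B = 𝟙-yes A? (Equivalence.from A⇔B b)
𝟙-cong A? (no ¬b) A⇔B = 𝟙-no A? (λ a → ¬b (Equivalence.to A⇔B a))

𝟙-s<s : ∀ m n → 𝟙 (suc m <? suc n) ≡ 𝟙 (m <? n)
𝟙-s<s m n = 𝟙-cong (suc m <? suc n) (m <? n) (mk⇔ s≤s⁻¹ s≤s)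

length-filter-tabulate : ∀ {a p} {A : Set a} {P : Pred A p} (P? : Decidable P) {n} (f : Fin n → A) →
  length (filter P? (tabulate f)) ≡ ∑[ i < n ] 𝟙 (P? (f i))
length-filter-tabulate P? {zero}  f = refl
length-filter-tabulate P? {suc n} f with P? (f zero)
... | yes _ = cong suc (length-filter-tabulate P? (λ i → f (suc i)))
... | no _  = length-filter-tabulate P? (λ i → f (suc i))

sum-const : ∀ n c → ∑[ _ < n ] c ≡ n * c
sum-const zero    c = refl
sum-const (suc n) c = cong (c +_) (sum-const n c)

count-toℕ< : ∀ {n a} → a ≤ n → ∑[ v < n ] 𝟙 (toℕ v <? a) ≡ a
count-toℕ< {n}     {zero}  _         =
  trans (sum-cong-≗ {n} (λ v → 𝟙-no (toℕ v <? 0) λ ())) (trans (sum-const n 0) (*-zeroʳ n))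
count-toℕ< {suc n} {suc a} (s≤s a≤n) = cong suc (trans
  (sum-cong-≗ {n} (λ v → 𝟙-s<s (toℕ v) a))
  (count-toℕ< a≤n))

count-<toℕ : ∀ n a → ∑[ v < n ] 𝟙 (a <? toℕ v) ≡ n ∸ suc a
count-<toℕ zero    a       = refl
count-<toℕ (suc n) zero    =
  trans (sum-cong-≗ {n} (λ v → 𝟙-yes (0 <? suc (toℕ v)) (s≤s z≤n))) (trans (sum-const n 1) (*-identityʳ n))
count-<toℕ (suc n) (suc a) = trans
  (sum-cong-≗ {n} (λ v → 𝟙-s<s a (toℕ v)))
  (count-<toℕ n a)

-- inv₁ π for π ∈ B_(m+1) with |π(1)| = a + 1, where s = true iff π(1) < 0.
inversions₁ : ℕ → Bool → ℕ → ℕ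
inversions₁ m false a = a
inversions₁ m true  a = 1 + a + 2 * (m ∸ a)

1+n+2*[m∸n]≡1+m+[m∸n] : ∀ {m n} → n ≤ m → 1 + n + 2 * (m ∸ n) ≡ 1 + m + (m ∸ n)
1+n+2*[m∸n]≡1+m+[m∸n] {m} {n} n≤m = cong suc (begin
  n + (m ∸ n + (m ∸ n + 0))  ≡⟨ cong (λ x → n + (m ∸ n + x)) (+-identityʳ (m ∸ n)) ⟩
  n + (m ∸ n + (m ∸ n))      ≡⟨ +-assoc n (m ∸ n) (m ∸ n) ⟨
  n + (m ∸ n) + (m ∸ n)      ≡⟨ cong (_+ (m ∸ n)) (m+[n∸m]≡n n≤m) ⟩
  m + (m ∸ n)                ∎)
  where open ≡-Reasoning

m<inversions₁-true : ∀ {m a} → a ≤ m → m < inversions₁ m true a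
m<inversions₁-true {m} {a} a≤m =
  subst (m <_) (sym (1+n+2*[m∸n]≡1+m+[m∸n] a≤m)) (s≤s (m≤m+n m (m ∸ a)))

inversions₁-injective : ∀ {m s t a b} → a ≤ m → b ≤ m →
  inversions₁ m s a ≡ inversions₁ m t b → s ≡ t × a ≡ b
inversions₁-injective {s = false} {false} _ _ e = refl , e
inversions₁-injective {s = false} {true}  a≤m b≤m e =
  contradiction e (<⇒≢ (≤-<-trans a≤m (m<inversions₁-true b≤m)))
inversions₁-injective {s = true}  {false} a≤m b≤m e =
  contradiction (sym e) (<⇒≢ (≤-<-trans b≤m (m<inversions₁-true a≤m)))
inversions₁-injective {m} {s = true} {true} {a} {b} a≤m b≤m e = refl ,
  ∸-cancelˡ-≡ a≤m b≤m (+-cancelˡ-≡ (1 + m) (m ∸ a) (m ∸ b) (begin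
    1 + m + (m ∸ a)       ≡⟨ 1+n+2*[m∸n]≡1+m+[m∸n] a≤m ⟨
    1 + a + 2 * (m ∸ a)   ≡⟨ e ⟩
    1 + b + 2 * (m ∸ b)   ≡⟨ 1+n+2*[m∸n]≡1+m+[m∸n] b≤m ⟩
    1 + m + (m ∸ b)       ∎))
  where open ≡-Reasoning

module _ {m : ℕ} (σ : SignedPerm (suc m)) where

  firstRank : ℕ
  firstRank = toℕ (perm σ ⟨$⟩ʳ zero)

  firstRank≤m : firstRank ≤ m
  firstRank≤m = s≤s⁻¹ (toℕ<n (perm σ ⟨$⟩ʳ zero))

  -- The condition 0 < k only excludes k = 0, which P already excludes.
  count-later-values : ∀ {p} {P : Pred ℕ p} (P? : Decidable P) → ¬ P (absVal σ zero) →
    length (filter (λ k → (0 <? toℕ k) ×-dec P? (absVal σ k)) (allFin (suc m)))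
      ≡ ∑[ v < suc m ] 𝟙 (P? (suc (toℕ v)))
  count-later-values {P = P} P? ¬P₀ = begin
    length (filter Q? (allFin (suc m)))  ≡⟨ length-filter-tabulate Q? id ⟩
    ∑[ k < suc m ] 𝟙 (Q? k)              ≡⟨ sum-cong-≗ {suc m} Q≗P ⟩
    ∑[ k < suc m ] 𝟙 (P? (absVal σ k))   ≡⟨ sum-permute {suc m} (λ v → 𝟙 (P? (suc (toℕ v)))) (perm σ) ⟨
    ∑[ v < suc m ] 𝟙 (P? (suc (toℕ v)))  ∎
    where
    open ≡-Reasoning
    Q? : Decidable (λ (k : Fin (suc m)) → 0 < toℕ k × P (absVal σ k))
    Q? k = (0 <? toℕ k) ×-dec P? (absVal σ k)
    Q≗P : ∀ k → 𝟙 (Q? k) ≡ 𝟙 (P? (absVal σ k))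
    Q≗P zero    = trans (𝟙-no (Q? zero) λ { (() , _) }) (sym (𝟙-no (P? (absVal σ zero)) ¬P₀))
    Q≗P (suc k) = 𝟙-cong (Q? (suc k)) (P? (absVal σ (suc k))) (mk⇔ (λ (_ , pk) → pk) (λ pk → s≤s z≤n , pk))

  countSmaller-firstRank : countSmaller σ zero (absVal σ zero) ≡ firstRank
  countSmaller-firstRank = begin
    countSmaller σ zero (absVal σ zero)              ≡⟨ count-later-values (_<? absVal σ zero) (n≮n _) ⟩
    ∑[ v < suc m ] 𝟙 (suc (toℕ v) <? suc firstRank)  ≡⟨ sum-cong-≗ {suc m} (λ v → 𝟙-s<s (toℕ v) firstRank) ⟩
    ∑[ v < suc m ] 𝟙 (toℕ v <? firstRank)            ≡⟨ count-toℕ< (≤-trans firstRank≤m (n≤1+n m)) ⟩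
    firstRank                                        ∎
    where open ≡-Reasoning

  countLarger-firstRank : countLarger σ zero (absVal σ zero) ≡ m ∸ firstRank
  countLarger-firstRank = begin
    countLarger σ zero (absVal σ zero)               ≡⟨ count-later-values (absVal σ zero <?_) (n≮n _) ⟩
    ∑[ v < suc m ] 𝟙 (suc firstRank <? suc (toℕ v))  ≡⟨ sum-cong-≗ {suc m} (λ v → 𝟙-s<s firstRank (toℕ v)) ⟩
    ∑[ v < suc m ] 𝟙 (firstRank <? toℕ v)            ≡⟨ count-<toℕ (suc m) firstRank ⟩
    m ∸ firstRank                                    ∎
    where open ≡-Reasoning

  inv-first : inv σ zero ≡ inversions₁ m (neg σ zero) firstRank
  inv-first with neg σ zero
  ... | false = countSmaller-firstRank
  ... | true  = cong₂ (λ s l → 1 + s + 2 * l) countSmaller-firstRank countLarger-firstRank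

value-cong : ∀ {n} {σ τ : SignedPerm n} {i j} →
  neg σ i ≡ neg τ j → absVal σ i ≡ absVal τ j → value σ i ≡ value τ j
value-cong {σ = σ} {τ} {i} {j} sign≡ abs≡ with neg σ i | neg τ j
value-cong refl abs≡ | false | false = cong ℤ.+_ abs≡
value-cong refl abs≡ | true  | true  = cong (λ k → ℤ.- (ℤ.+ k)) abs≡

lemma3p3 : (m : ℕ) (σ τ : SignedPerm (suc m)) →
    value σ zero ≢ value τ zero → inv σ zero ≢ inv τ zero
lemma3p3 m σ τ value≢ inv≡ with inversions₁-injective (firstRank≤m σ) (firstRank≤m τ)
                                  (trans (sym (inv-first σ)) (trans inv≡ (inv-first τ)))
... | sign≡ , rank≡ = value≢ (value-cong {σ = σ} {τ} {zero} {zero} sign≡ (cong suc rank≡))
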